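{- Consider integers $k,m,\alpha \in \mathbb{Z}_{\ge 0}$ with $\alpha \ge \lfloor 8\ell_k\rfloor$ and $i,i'\in [m+2\alpha .. n - \alpha]$ such that $S(i-m-2\alpha .. i + \alpha] = S(i' -m- 2\alpha .. i' + \alpha]$. 1. If $i\in B_k$, then $i'\in B_k$. 2. If $S(i-m.. i]$ is a level-$k$ phrase, then $S(i'-m.. i']$ is a level-$k$ phrase corresponding to the same symbol in $S_k$.
   Context: Notation: $[a..b]$, $[a..b)$, $(a..b]$ denote integer intervals; for a string $S[1..n]$, $S(i..j]=S[i+1]\cdots S[j]$ and $S[i..j]$, $S[i..j)$ analogously. Let $S\in\Sigma^n$, $\Sigma=[0..\sigma)$. Let $\mathcal{A}$ be the least set with $\mathcal{A}=\Sigma\cup(\mathcal{A}\times\mathbb{Z}_{\ge2})\cup\bigcup_{i\ge2}\mathcal{A}^i$, with expansion $\mathrm{exp}(a)=a$ for $a\in\Sigma$, $\mathrm{exp}((A_1,\ldots,A_i))=\mathrm{exp}(A_1)\cdots\mathrm{exp}(A_i)$, $\mathrm{exp}((B,m))=\mathrm{exp}(B)^m$, extended homomorphically to strings. Restricted block compression: let $\ell_k=(4/3)^{\lceil k/2\rceil-1}$ and $\mathcal{A}_k=\{A\in\mathcal{A}:|\mathrm{exp}(A)|\le\ell_k\}$. Set $S_0=S$. For odd $k>0$, $S_k$ is obtained from $T=S_{k-1}$ by placing a block boundary between $T[i]$ and $T[i+1]$ whenever $T[i]\notin\mathcal{A}_k$, $T[i+1]\notin\mathcal{A}_k$, or $T[i]\ne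 T[i+1]$, and replacing each block $A^m$ with $m\ge2$ by the symbol $(A,m)$. For even $k>0$, with $\pi_k$ a bijection from the set of symbols occurring in $S_{k-1}$ to $[1..|\Sigma(S_{k-1})|]$ such that $\pi_k(A)<\pi_k(B)$ whenever $A\notin\mathcal{A}_k$ and $B\in\mathcal{A}_k$, $S_k$ is obtained from $T=S_{k-1}$ by placing a block boundary between $T[i]$ and $T[i+1]$ whenever $T[i]\notin\mathcal{A}_k$, $T[i+1]\notin\mathcal{A}_k$, or $i$ is a local minimum (i.e., $1<i<|T|$ and $\pi_k(T[i-1])>\pi_k(T[i])<\pi_k(T[i+1])$), and replacing each block $T[i..i+m)$ with $m\ge2$ by the symbol $(T[i],\ldots,T[i+m-1])$. Then $\mathrm{exp}(S_k)=S$ for all $k$. The level-$k$ phrases are the fragments $S(|\mathrm{exp}(S_k[1..j))|..|\mathrm{exp}(S_k[1..j])|]=\mathrm{exp}(S_k[j])$ for $j\in[1..|S_k|]$, and $B_k=\{|\mathrm{exp}(S_k[1..j])|:j\in[0..|S_k|]\}\subseteq[0..n]$ is the set of level-$k$ phrase boundaries. -}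

module Defs where

open import Data.Nat using (ℕ; zero; suc; _+_; _*_; _∸_; _^_; _≤_; _<_; _>_; ⌊_/2⌋)
open import Data.Nat.DivMod using (_/_)
open import Data.Nat.Properties using (m^n≢0)
open import Data.Bool using (Bool; true; false; if_then_else_)
open import Data.List using (List; []; _∷_; _++_; length; map; take; drop; concat)
open import Data.List.Membership.Propositional using (_∈_)
open import Data.List.Relation.Unary.All using (All)
open import Data.Maybe using (Maybe; just; nothing)
open import Data.Product using (Σ; ∃; _×_; _,_)
open import Data.Sum using (_⊎_)
open import Relation.Nullary using (¬_)
open import Relation.Binary.PropositionalEquality using (_≡_; _≢_)
open import Function.Bundles using (_⇔_)

-- Symbols of 𝒜 (leaf a ∈ Σ ; run B m = (B,m) ; blk (A₁,…,Aᵢ)).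
-- The compression only ever creates run with m ≥ 2 and blk with i ≥ 2.

data Sym : Set where
  leaf : ℕ → Sym
  run  : Sym → ℕ → Sym
  blk  : List Sym → Sym

rep : ℕ → List ℕ → List ℕ
rep zero    xs = []
rep (suc m) xs = xs ++ rep m xs

mutual
  expS : Sym → List ℕ
  expS (leaf a)  = a ∷ []
  expS (run B m) = rep m (expS B)
  expS (blk As)  = expL As

  expL : List Sym → List ℕ
  expL []       = []
  expL (A ∷ As) = expS A ++ expL As

-- |exp(A)| ≤ ℓ_k, for k ≥ 1, where ℓ_k = (4/3)^j with j = ⌈k/2⌉-1 = ⌊(k-1)/2⌋
InA : ℕ → Sym → Set
InA k A = length (expS A) * 3 ^ ⌊ k ∸ 1 /2⌋ ≤ 4 ^ ⌊ k ∸ 1 /2⌋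

-- ⌊8 ℓ_k⌋ ; for k = 0, ℓ_0 = (4/3)^(-1) = 3/4, so ⌊8 ℓ_0⌋ = 6
floor8ℓ : ℕ → ℕ
floor8ℓ zero    = 6
floor8ℓ (suc k) = (8 * 4 ^ ⌊ k /2⌋) / (3 ^ ⌊ k /2⌋)
  where instance _ = m^n≢0 3 ⌊ k /2⌋

-- 1-indexed access T[i]
get : {A : Set} → List A → ℕ → Maybe A
get []       _             = nothing
get (x ∷ xs) zero          = nothing
get (x ∷ xs) (suc zero)    = just x
get (x ∷ xs) (suc (suc i)) = get xs (suc i)

sub : {A : Set} → List A → ℕ → ℕ → List A
sub S a b = take (b ∸ a) (drop a S)

isOdd : ℕ → Bool
isOdd zero          = false
isOdd (suc zero)    = true
isOdd (suc (suc k)) = isOdd k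

-- Block boundaries (between T[i] and T[i+1], i ∈ [1..|T|))

OddBd : ℕ → List Sym → ℕ → Set
OddBd k T i = Σ Sym λ A → Σ Sym λ B → get T i ≡ just A × get T (suc i) ≡ just B
  × (¬ InA k A ⊎ ¬ InA k B ⊎ A ≢ B)

LocMin : (Sym → ℕ) → List Sym → ℕ → Set
LocMin π T i = 1 < i × (Σ Sym λ C → Σ Sym λ A → Σ Sym λ B →
  get T (i ∸ 1) ≡ just C × get T i ≡ just A × get T (suc i) ≡ just B
  × π C > π A × π A < π B)

EvenBd : ℕ → (Sym → ℕ) → List Sym → ℕ → Set
EvenBd k π T i = Σ Sym λ A → Σ Sym λ B → get T i ≡ just A × get T (suc i) ≡ just B
  × (¬ InA k A ⊎ ¬ InA k B ⊎ LocMin π T i)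

NonEmpty : List Sym → Set
NonEmpty xs = Σ Sym λ y → Σ (List Sym) λ ys → xs ≡ y ∷ ys

IsCut : List (List Sym) → ℕ → Set
IsCut bs i = Σ ℕ λ j → length (concat (take j bs)) ≡ i

Grouping : List Sym → (ℕ → Set) → List (List Sym) → Set
Grouping T Bd bs = All NonEmpty bs × concat bs ≡ T
  × (∀ i → 1 ≤ i → i < length T → (Bd i ⇔ IsCut bs i))

-- block A^m (m ≥ 2) ↦ (A,m)
mkRun : List Sym → Sym
mkRun []            = leaf 0   -- never used (blocks are nonempty)
mkRun (A ∷ [])      = A
mkRun (A ∷ B ∷ r)   = run A (length r + 2)

mkBlk : List Sym → Sym
mkBlk []            = leaf 0   -- never used
mkBlk (A ∷ [])      = A
mkBlk (A ∷ B ∷ r)   = blk (A ∷ B ∷ r)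

ValidPerm : ℕ → List Sym → (Sym → ℕ) → Set
ValidPerm k T π = (Σ ℕ λ d →
      (∀ A → A ∈ T → 1 ≤ π A × π A ≤ d)
    × (∀ j → 1 ≤ j → j ≤ d → Σ Sym λ A → A ∈ T × π A ≡ j))
  × (∀ A B → A ∈ T → B ∈ T → π A ≡ π B → A ≡ B)
  × (∀ A B → A ∈ T → B ∈ T → ¬ InA k A → InA k B → π A < π B)

OddStep : ℕ → List Sym → List Sym → Set
OddStep k T T' = Σ (List (List Sym)) λ bs →
  Grouping T (OddBd k T) bs × T' ≡ map mkRun bs

EvenStep : ℕ → List Sym → List Sym → Set
EvenStep k T T' = Σ (Sym → ℕ) λ π → ValidPerm k T π ×
  (Σ (List (List Sym)) λ bs → Grouping T (EvenBd k π T) bs × T' ≡ map mkBlk bs)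

Step : ℕ → List Sym → List Sym → Set
Step k T T' = if isOdd k then OddStep k T T' else EvenStep k T T'

-- Level S k Sₖ : Sₖ is a valid level-k string of the restricted block
-- compression of S (for some admissible choice of π₂, π₄, …, πₖ)
data Level (S : List ℕ) : ℕ → List Sym → Set where
  lvl0 : Level S 0 (map leaf S)
  lvlS : ∀ {k T T'} → Level S k T → Step (suc k) T T' → Level S (suc k) T'

InB : List Sym → ℕ → Set
InB Sk i = Σ ℕ λ j → j ≤ length Sk × length (expL (take j Sk)) ≡ i

PhraseAt : List Sym → ℕ → Sym → ℕ → ℕ → Set
PhraseAt Sk j A a b = get Sk j ≡ just A
  × length (expL (take (j ∸ 1) Sk)) ≡ a × length (expL (take j Sk)) ≡ b

-- Let radius k = Σ_{j<k} ⌊ℓ_{j+1}⌋. By induction on k: if S agrees on two windows, every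
-- level-k segment lying at offsets s ≤ t of the first window with 2·radius k ≤ s and
-- t + radius k ≤ len also lies at the same offsets of the second window.
-- A level-(k+1) cut between adjacent symbols X Y is decided by X and Y and, at even levels,
-- by the symbol W preceding X. On the second side, a neighbour of the boundary that lies in
-- 𝒜_{k+1} is a level-k phrase of length at most ⌊ℓ_{k+1}⌋, so the induction hypothesis
-- carries it back to the first side, where it must coincide with the corresponding neighbour;
-- a neighbour outside 𝒜_{k+1} forces the cut by itself, and W ∉ 𝒜_{k+1} cannot precede a
-- local minimum X ∈ 𝒜_{k+1} because π ranks it lower. Hence cuts, and so boundaries,
-- transfer with radius k + ⌊ℓ_{k+1}⌋. A level-(k+1) phrase lies between two boundaries that
-- transfer in both directions, so it reappears in the other window, with the same symbol
-- since the symbol is built from the level-k segment it covers. Finally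
-- radius k ≤ ⌊8ℓ_k⌋ ≤ α, so the given windows S(i-m-2α..i+α] leave enough room.

module Submission where

open import Defs
open import Data.Nat using (ℕ; zero; suc; _+_; _*_; _∸_; _≤_; _≥_; _<_; _>_; z≤n; s≤s; ⌊_/2⌋; _^_)
import Data.Nat as ℕ
open import Data.Nat.Properties
open import Data.Nat.DivMod using (_/_; m*n/n≡m; n/n≡1; /-monoˡ-≤; m/n*n≤m)
open import Data.Nat.Tactic.RingSolver using (solve-∀)
open import Data.List using (List; []; _∷_; _++_; _∷ʳ_; length; map; take; drop; concat; initLast; _∷ʳ′_)
open import Data.List.Properties
open import Data.List.Relation.Unary.All using (All; []; _∷_)
import Data.List.Relation.Unary.All as All
import Data.List.Relation.Unary.All.Properties as All
open import Data.List.Relation.Unary.Any using (here)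
open import Data.List.Membership.Propositional using (_∈_)
open import Data.List.Membership.Propositional.Properties using (∈-++⁺ʳ)
open import Data.Product using (Σ; _×_; _,_; proj₁; proj₂)
open import Data.Sum using (_⊎_; inj₁; inj₂)
import Data.Sum as Sum
open import Data.Empty using (⊥-elim)
open import Data.Maybe using (just)
open import Data.Maybe.Properties using (just-injective)
open import Data.Bool using (true; false)
open import Function.Base using (_∘_)
open import Function.Bundles using (_⇔_; mk⇔; Equivalence)
import Function.Properties.Equivalence as ⇔
open import Relation.Nullary using (¬_; Dec; yes; no)
open import Relation.Nullary.Decidable using (decidable-stable)
open import Relation.Binary.PropositionalEquality

++-prefixes-comparable : ∀ {X : Set} (L₁ L₂ M₁ M₂ : List X) → L₁ ++ L₂ ≡ M₁ ++ M₂ →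
  (Σ (List X) λ D → L₁ ≡ M₁ ++ D) ⊎ (Σ (List X) λ D → M₁ ≡ L₁ ++ D)
++-prefixes-comparable []       L₂ M₁       M₂ eq = inj₂ (M₁ , refl)
++-prefixes-comparable (x ∷ L₁) L₂ []       M₂ eq = inj₁ (x ∷ L₁ , refl)
++-prefixes-comparable (x ∷ L₁) L₂ (y ∷ M₁) M₂ eq with ∷-injective eq
... | refl , eq′ with ++-prefixes-comparable L₁ L₂ M₁ M₂ eq′
... | inj₁ (D , e) = inj₁ (D , cong (x ∷_) e)
... | inj₂ (D , e) = inj₂ (D , cong (x ∷_) e)

++-cancel-length : ∀ {X : Set} (L₁ L₂ M₁ M₂ : List X) → L₁ ++ L₂ ≡ M₁ ++ M₂ → length L₁ ≡ length M₁ →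
  L₁ ≡ M₁ × L₂ ≡ M₂
++-cancel-length []       L₂ []       M₂ eq _ = refl , eq
++-cancel-length (x ∷ L₁) L₂ (y ∷ M₁) M₂ eq e with ∷-injective eq
... | refl , eq′ with ++-cancel-length L₁ L₂ M₁ M₂ eq′ (suc-injective e)
... | e₁ , e₂ = cong (x ∷_) e₁ , e₂

length-∷ʳ : ∀ {X : Set} (L : List X) (x : X) → length (L ∷ʳ x) ≡ suc (length L)
length-∷ʳ L x = trans (length-++ L) (+-comm (length L) 1)

∷ʳ-++-∷ : ∀ {X : Set} (L : List X) x M → (L ∷ʳ x) ++ M ≡ L ++ x ∷ M
∷ʳ-++-∷ L x M = ++-assoc L (x ∷ []) M

length-<-++-∷ : ∀ {X : Set} (L : List X) y M → length L < length (L ++ y ∷ M)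
length-<-++-∷ L y M = subst (length L <_) (sym (length-++ L)) (m<m+n (length L) (s≤s z≤n))

suc-length-<-++-∷-∷ : ∀ {X : Set} (L : List X) x y M → suc (length L) < length (L ++ x ∷ y ∷ M)
suc-length-<-++-∷-∷ []      x y M = s≤s (s≤s z≤n)
suc-length-<-++-∷-∷ (z ∷ L) x y M = s≤s (suc-length-<-++-∷-∷ L x y M)

take-length-++ : ∀ {X : Set} (L M : List X) → take (length L) (L ++ M) ≡ L
take-length-++ []      M = refl
take-length-++ (x ∷ L) M = cong (x ∷_) (take-length-++ L M)

drop-length-++ : ∀ {X : Set} (L M : List X) → drop (length L) (L ++ M) ≡ M
drop-length-++ []      M = refl
drop-length-++ (x ∷ L) M = drop-length-++ L M

take-suc-length-++ : ∀ {X : Set} (L : List X) A M → take (suc (length L)) (L ++ A ∷ M) ≡ L ∷ʳ A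
take-suc-length-++ []      A M = refl
take-suc-length-++ (x ∷ L) A M = cong (x ∷_) (take-suc-length-++ L A M)

length-take-≤ : ∀ {X : Set} m (S : List X) → m ≤ length S → length (take m S) ≡ m
length-take-≤ m S m≤S = trans (length-take m S) (m≤n⇒m⊓n≡m m≤S)

take-drop-+ : ∀ {X : Set} (S : List X) c s m → take m (drop (c + s) S) ≡ drop s (take (s + m) (drop c S))
take-drop-+ S c s m = trans (cong (take m) (sym (drop-drop c s S))) (take-drop m s (drop c S))

get-suc-length-++ : ∀ {X : Set} (L : List X) x M → get (L ++ x ∷ M) (suc (length L)) ≡ just x
get-suc-length-++ []          x M = refl
get-suc-length-++ (y ∷ [])    x M = refl
get-suc-length-++ (y ∷ z ∷ L) x M = get-suc-length-++ (z ∷ L) x M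

get-suc-suc-length-++ : ∀ {X : Set} (L : List X) x y M → get (L ++ x ∷ y ∷ M) (suc (suc (length L))) ≡ just y
get-suc-suc-length-++ []      x y M = refl
get-suc-suc-length-++ (z ∷ L) x y M = get-suc-suc-length-++ L x y M

get⇒split : ∀ {X : Set} (T : List X) j A → get T j ≡ just A →
  Σ (List X) λ L₁ → Σ (List X) λ L₂ → T ≡ L₁ ++ A ∷ L₂ × j ≡ suc (length L₁)
get⇒split (x ∷ T) (suc zero)    A refl = [] , T , refl , refl
get⇒split (x ∷ T) (suc (suc j)) A e with get⇒split T (suc j) A e
... | L₁ , L₂ , refl , refl = x ∷ L₁ , L₂ , refl , refl

map-++-inv : ∀ {X Y : Set} (f : X → Y) xs U V → map f xs ≡ U ++ V →
  Σ (List X) λ ys → Σ (List X) λ zs → xs ≡ ys ++ zs × U ≡ map f ys × V ≡ map f zs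
map-++-inv f xs       []      V e = [] , xs , refl , refl , sym e
map-++-inv f (x ∷ xs) (u ∷ U) V e with ∷-injective e
... | refl , e′ with map-++-inv f xs U V e′
... | ys , zs , refl , refl , refl = x ∷ ys , zs , refl , refl , refl

∈-middle : ∀ {X : Set} {T} (L : List X) x M → T ≡ L ++ x ∷ M → x ∈ T
∈-middle L x M refl = ∈-++⁺ʳ L (here refl)

+≡⇒≡+∸ : ∀ {a m c s} → a + m ≡ c + s → m ≤ s → a ≡ c + (s ∸ m)
+≡⇒≡+∸ {a} {m} {c} {s} e m≤s = +-cancelʳ-≡ m a (c + (s ∸ m))
  (trans e (trans (cong (c +_) (sym (m∸n+n≡m m≤s))) (sym (+-assoc c (s ∸ m) m))))

∣_∣ : Sym → ℕ
∣ A ∣ = length (expS A)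

∥_∥ : List Sym → ℕ
∥ L ∥ = length (expL L)

expL-++ : ∀ L M → expL (L ++ M) ≡ expL L ++ expL M
expL-++ []      M = refl
expL-++ (A ∷ L) M = trans (cong (expS A ++_) (expL-++ L M)) (sym (++-assoc (expS A) (expL L) (expL M)))

∥++∥ : ∀ L M → ∥ L ++ M ∥ ≡ ∥ L ∥ + ∥ M ∥
∥++∥ L M = trans (cong length (expL-++ L M)) (length-++ (expL L))

∥∷∥ : ∀ A L → ∥ A ∷ L ∥ ≡ ∣ A ∣ + ∥ L ∥
∥∷∥ A L = length-++ (expS A)

∥[-]∥ : ∀ A → ∥ A ∷ [] ∥ ≡ ∣ A ∣
∥[-]∥ A = trans (∥∷∥ A []) (+-identityʳ _)

Positive : List Sym → Set
Positive = All (λ A → 0 < ∣ A ∣)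

∥∥-positive : ∀ A L → Positive (A ∷ L) → 0 < ∥ A ∷ L ∥
∥∥-positive A L (p ∷ _) = subst (0 <_) (sym (∥∷∥ A L)) (≤-trans p (m≤m+n _ _))

∥∥-cancel : ∀ L₁ L₂ M₁ M₂ → Positive L₁ → Positive M₁ → L₁ ++ L₂ ≡ M₁ ++ M₂ → ∥ L₁ ∥ ≡ ∥ M₁ ∥ →
  L₁ ≡ M₁ × L₂ ≡ M₂
∥∥-cancel []       L₂ []       M₂ _ _ eq _ = refl , eq
∥∥-cancel []       L₂ (B ∷ M₁) M₂ _ q eq e = ⊥-elim (<-irrefl e (∥∥-positive B M₁ q))
∥∥-cancel (A ∷ L₁) L₂ []       M₂ p _ eq e = ⊥-elim (<-irrefl (sym e) (∥∥-positive A L₁ p))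
∥∥-cancel (A ∷ L₁) L₂ (B ∷ M₁) M₂ (_ ∷ p) (_ ∷ q) eq e with ∷-injective eq
... | refl , eq′ with ∥∥-cancel L₁ L₂ M₁ M₂ p q eq′
                      (+-cancelˡ-≡ ∣ A ∣ _ _ (trans (sym (∥∷∥ A L₁)) (trans e (∥∷∥ A M₁))))
... | e₁ , e₂ = cong (A ∷_) e₁ , e₂

positive-prefix : ∀ {T} L₁ L₂ → Positive T → T ≡ L₁ ++ L₂ → Positive L₁
positive-prefix L₁ L₂ p refl = All.++⁻ˡ L₁ p

positive-suffix : ∀ {T} L₁ L₂ → Positive T → T ≡ L₁ ++ L₂ → Positive L₂
positive-suffix L₁ L₂ p refl = All.++⁻ʳ L₁ p

-- Boundaries, segments and phrases of a string of symbols

Boundary : List Sym → ℕ → Set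
Boundary T p = Σ (List Sym) λ L₁ → Σ (List Sym) λ L₂ → T ≡ L₁ ++ L₂ × ∥ L₁ ∥ ≡ p

Segment : List Sym → ℕ → ℕ → List Sym → Set
Segment T x y L = Σ (List Sym) λ L₁ → Σ (List Sym) λ L₂ → T ≡ L₁ ++ (L ++ L₂) × ∥ L₁ ∥ ≡ x × x + ∥ L ∥ ≡ y

Phrase : List Sym → ℕ → ℕ → Sym → Set
Phrase T x y A = Segment T x y (A ∷ [])

segment-unique : ∀ {T x y L L′} → Positive T → Segment T x y L → Segment T x y L′ → L ≡ L′
segment-unique {T} {x} {y} {L} {L′} pT (L₁ , L₂ , e₁ , a₁ , b₁) (M₁ , M₂ , e₂ , a₂ , b₂)
  with ∥∥-cancel L₁ (L ++ L₂) M₁ (L′ ++ M₂) (positive-prefix L₁ _ pT e₁) (positive-prefix M₁ _ pT e₂)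
         (trans (sym e₁) e₂) (trans a₁ (sym a₂))
... | refl , e₃ = proj₁ (∥∥-cancel L L₂ L′ M₂ (positive-prefix L L₂ (positive-suffix L₁ _ pT e₁) refl)
                          (positive-prefix L′ M₂ (positive-suffix M₁ _ pT e₂) refl) e₃
                          (+-cancelˡ-≡ x _ _ (trans b₁ (sym b₂))))

segment-start : ∀ {T x y L} → Segment T x y L → Boundary T x
segment-start {L = L} (L₁ , L₂ , e , a , _) = L₁ , L ++ L₂ , e , a

segment-end : ∀ {T x y L} → Segment T x y L → Boundary T y
segment-end {x = x} {L = L} (L₁ , L₂ , e , a , b) =
  L₁ ++ L , L₂ , trans e (sym (++-assoc L₁ L L₂)) , trans (∥++∥ L₁ L) (trans (cong (_+ ∥ L ∥) a) b)

segment-≤ : ∀ {T x y L} → Segment T x y L → x ≤ y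
segment-≤ {x = x} (_ , _ , _ , _ , b) = subst (x ≤_) b (m≤m+n _ _)

boundary⇒segment-[] : ∀ {T x} → Boundary T x → Segment T x x []
boundary⇒segment-[] {x = x} (L₁ , L₂ , e , a) = L₁ , L₂ , e , a , +-identityʳ x

segment-uncons : ∀ {T x y A L} → Segment T x y (A ∷ L) → Phrase T x (x + ∣ A ∣) A × Segment T (x + ∣ A ∣) y L
segment-uncons {x = x} {A = A} {L = L} (L₁ , L₂ , e , a , b) =
  (L₁ , L ++ L₂ , e , a , cong (x +_) (∥[-]∥ A)) ,
  (L₁ ∷ʳ A , L₂ , trans e (sym (++-assoc L₁ (A ∷ []) (L ++ L₂))) ,
    trans (∥++∥ L₁ (A ∷ [])) (cong₂ _+_ a (∥[-]∥ A)) ,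
    trans (+-assoc x ∣ A ∣ ∥ L ∥) (trans (cong (x +_) (sym (∥∷∥ A L))) b))

segment-cons : ∀ {T x z y A L} → Positive T → Phrase T x z A → Segment T z y L → Segment T x y (A ∷ L)
segment-cons {T} {x} {z} {y} {A} {L} pT (L₁ , L₂ , e₁ , a₁ , b₁) (M₁ , M₂ , e₂ , a₂ , b₂)
  with ∥∥-cancel (L₁ ∷ʳ A) L₂ M₁ (L ++ M₂)
         (positive-prefix _ L₂ pT (trans e₁ (sym (++-assoc L₁ (A ∷ []) L₂))))
         (positive-prefix M₁ _ pT e₂)
         (trans (++-assoc L₁ (A ∷ []) L₂) (trans (sym e₁) e₂))
         (trans (∥++∥ L₁ (A ∷ [])) (trans (cong (_+ ∥ A ∷ [] ∥) a₁) (trans b₁ (sym a₂))))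
... | refl , refl = L₁ , M₂ , trans e₂ (++-assoc L₁ (A ∷ []) (L ++ M₂)) , a₁ , end
  where
  open ≡-Reasoning
  end : x + ∥ A ∷ L ∥ ≡ y
  end = begin
    x + ∥ A ∷ L ∥     ≡⟨ cong (x +_) (∥∷∥ A L) ⟩
    x + (∣ A ∣ + ∥ L ∥) ≡⟨ +-assoc x ∣ A ∣ ∥ L ∥ ⟨
    x + ∣ A ∣ + ∥ L ∥   ≡⟨ cong (λ w → x + w + ∥ L ∥) (∥[-]∥ A) ⟨
    x + ∥ A ∷ [] ∥ + ∥ L ∥ ≡⟨ cong (_+ ∥ L ∥) b₁ ⟩
    z + ∥ L ∥           ≡⟨ b₂ ⟩
    y ∎

phrase-length : ∀ {T x y A} → Phrase T x y A → x + ∣ A ∣ ≡ y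
phrase-length {A = A} (_ , _ , _ , _ , b) = trans (cong (_ +_) (sym (∥[-]∥ A))) b

phrase-< : ∀ {T x y A} → Positive T → Phrase T x y A → x < y
phrase-< {T} {x} {y} {A} pT ph@(L₁ , L₂ , e , a , b) with positive-suffix L₁ (A ∷ L₂) pT e
... | pA ∷ _ = subst (x <_) (phrase-length ph) (m<m+n x pA)

phrase-end-≤-boundary : ∀ {T x y z A} → Positive T → Phrase T x y A → Boundary T z → x < z → y ≤ z
phrase-end-≤-boundary {T} {x} {y} {z} {A} pT ph@(L₁ , L₂ , e₁ , a₁ , b₁) (M₁ , M₂ , e₂ , a₂) x<z
  with ++-prefixes-comparable L₁ (A ∷ L₂) M₁ M₂ (trans (sym e₁) e₂)
... | inj₁ (D , refl) = ⊥-elim (<⇒≱ x<z (begin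
  z              ≡⟨ a₂ ⟨
  ∥ M₁ ∥         ≤⟨ m≤m+n _ _ ⟩
  ∥ M₁ ∥ + ∥ D ∥ ≡⟨ ∥++∥ M₁ D ⟨
  ∥ M₁ ++ D ∥    ≡⟨ a₁ ⟩
  x              ∎))
  where open ≤-Reasoning
... | inj₂ ([] , refl) = ⊥-elim (<-irrefl (trans (sym a₁) (trans (cong ∥_∥ (sym (++-identityʳ L₁))) a₂)) x<z)
... | inj₂ (B ∷ D , refl)
  with ∷-injective (++-cancelˡ L₁ (A ∷ L₂) (B ∷ D ++ M₂) (trans (sym e₁) (trans e₂ (++-assoc L₁ (B ∷ D) M₂))))
... | refl , _ = begin
  y                  ≡⟨ phrase-length ph ⟨
  x + ∣ A ∣          ≤⟨ +-monoʳ-≤ x (m≤m+n ∣ A ∣ ∥ D ∥) ⟩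
  x + (∣ A ∣ + ∥ D ∥) ≡⟨ cong₂ _+_ a₁ (∥∷∥ A D) ⟨
  ∥ L₁ ∥ + ∥ A ∷ D ∥  ≡⟨ ∥++∥ L₁ (A ∷ D) ⟨
  ∥ L₁ ++ A ∷ D ∥     ≡⟨ a₂ ⟩
  z                  ∎
  where open ≤-Reasoning

phrase-end-unique : ∀ {T x x′ y A B} → Positive T → Phrase T x y A → Phrase T x′ y B → A ≡ B
phrase-end-unique {T} {x} {x′} {y} {A} {B} pT (L₁ , L₂ , e₁ , a₁ , b₁) (M₁ , M₂ , e₂ , a₂ , b₂)
  with ∥∥-cancel (L₁ ∷ʳ A) L₂ (M₁ ∷ʳ B) M₂
         (positive-prefix _ L₂ pT (trans e₁ (sym (++-assoc L₁ (A ∷ []) L₂))))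
         (positive-prefix _ M₂ pT (trans e₂ (sym (++-assoc M₁ (B ∷ []) M₂))))
         (trans (++-assoc L₁ (A ∷ []) L₂) (trans (sym e₁) (trans e₂ (sym (++-assoc M₁ (B ∷ []) M₂)))))
         (trans (∥++∥ L₁ (A ∷ [])) (trans (cong (_+ ∥ A ∷ [] ∥) a₁)
           (trans b₁ (sym (trans (∥++∥ M₁ (B ∷ [])) (trans (cong (_+ ∥ B ∷ [] ∥) a₂) b₂))))))
... | e , _ = proj₂ (∷ʳ-injective L₁ M₁ e)

phrase-start-unique : ∀ {T x y y′ A B} → Positive T → Phrase T x y A → Phrase T x y′ B → A ≡ B
phrase-start-unique pT (L₁ , L₂ , e₁ , a₁ , _) (M₁ , M₂ , e₂ , a₂ , _)
  with ∥∥-cancel L₁ _ M₁ _ (positive-prefix L₁ _ pT e₁) (positive-prefix M₁ _ pT e₂) (trans (sym e₁) e₂) (trans a₁ (sym a₂))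
... | _ , e = proj₁ (∷-injective e)

SplitAt : List Sym → ℕ → List Sym → Sym → Sym → List Sym → Set
SplitAt T p L₀ X Y L₄ = T ≡ (L₀ ∷ʳ X) ++ Y ∷ L₄ × ∥ L₀ ∷ʳ X ∥ ≡ p

split-left : ∀ {T p L₀ X Y L₄} → SplitAt T p L₀ X Y L₄ → Phrase T ∥ L₀ ∥ p X
split-left {L₀ = L₀} {X} {Y} {L₄} (e , a) = L₀ , Y ∷ L₄ , trans e (∷ʳ-++-∷ L₀ X (Y ∷ L₄)) , refl , trans (sym (∥++∥ L₀ (X ∷ []))) a

split-right : ∀ {T p L₀ X Y L₄} → SplitAt T p L₀ X Y L₄ → Phrase T p (p + ∣ Y ∣) Y
split-right {L₀ = L₀} {X} {Y} {L₄} (e , a) = L₀ ∷ʳ X , L₄ , e , a , cong (_ +_) (∥[-]∥ Y)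

split-∈ : ∀ {T p L₀ X Y L₄} → SplitAt T p L₀ X Y L₄ → X ∈ T
split-∈ {L₀ = L₀} {X} {Y} {L₄} sp = ∈-middle L₀ X (Y ∷ L₄) (trans (proj₁ sp) (∷ʳ-++-∷ L₀ X (Y ∷ L₄)))

split-∈-before : ∀ {T p L₀ X Y L₄ L₀₀ W} → SplitAt T p L₀ X Y L₄ → L₀ ≡ L₀₀ ∷ʳ W → W ∈ T
split-∈-before {L₀₀ = L₀₀} sp refl = split-∈ {L₀ = L₀₀} (trans (proj₁ sp) (∷ʳ-++-∷ (L₀₀ ∷ʳ _) _ _) , refl)

inB⇒boundary : ∀ {T p} → InB T p → Boundary T p
inB⇒boundary {T} (j , _ , e) = take j T , drop j T , sym (take++drop≡id j T) , e

boundary⇒inB : ∀ {T p} → Boundary T p → InB T p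
boundary⇒inB (L₁ , L₂ , refl , a) =
  length L₁ , length-++-≤ˡ L₁ , trans (cong ∥_∥ (take-length-++ L₁ L₂)) a

phraseAt⇒phrase : ∀ {T j A x y} → PhraseAt T j A x y → Phrase T x y A
phraseAt⇒phrase {T} {j} {A} {x} {y} (g , ea , eb) with get⇒split T j A g
... | L₁ , L₂ , refl , refl = L₁ , L₂ , refl , start , end
  where
  start : ∥ L₁ ∥ ≡ x
  start = trans (cong ∥_∥ (sym (take-length-++ L₁ (A ∷ L₂)))) ea
  end : x + ∥ A ∷ [] ∥ ≡ y
  end = trans (cong (_+ ∥ A ∷ [] ∥) (sym start))
          (trans (sym (∥++∥ L₁ (A ∷ []))) (trans (cong ∥_∥ (sym (take-suc-length-++ L₁ A L₂))) eb))

phrase⇒phraseAt : ∀ {T A x y} → Phrase T x y A → Σ ℕ λ j → PhraseAt T j A x y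
phrase⇒phraseAt {A = A} (L₁ , L₂ , refl , ea , eb) = suc (length L₁) , get-suc-length-++ L₁ A L₂ ,
  trans (cong ∥_∥ (take-length-++ L₁ (A ∷ L₂))) ea ,
  trans (cong ∥_∥ (take-suc-length-++ L₁ A L₂)) (trans (∥++∥ L₁ (A ∷ [])) (trans (cong (_+ ∥ A ∷ [] ∥) ea) eb))

-- One compression step

mutual
  _≟ₛ_ : (A B : Sym) → Dec (A ≡ B)
  leaf a ≟ₛ leaf b with a ℕ.≟ b
  ... | yes refl = yes refl
  ... | no a≢b   = no λ { refl → a≢b refl }
  leaf _ ≟ₛ run _ _ = no λ ()
  leaf _ ≟ₛ blk _   = no λ ()
  run _ _ ≟ₛ leaf _ = no λ ()
  run A m ≟ₛ run B n with A ≟ₛ B | m ℕ.≟ n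
  ... | yes refl | yes refl = yes refl
  ... | no A≢B   | _        = no λ { refl → A≢B refl }
  ... | _        | no m≢n   = no λ { refl → m≢n refl }
  run _ _ ≟ₛ blk _  = no λ ()
  blk _ ≟ₛ leaf _   = no λ ()
  blk _ ≟ₛ run _ _  = no λ ()
  blk As ≟ₛ blk Bs with As ≟ₗ Bs
  ... | yes refl = yes refl
  ... | no As≢Bs = no λ { refl → As≢Bs refl }

  _≟ₗ_ : (As Bs : List Sym) → Dec (As ≡ Bs)
  []       ≟ₗ []       = yes refl
  []       ≟ₗ (_ ∷ _)  = no λ ()
  (_ ∷ _)  ≟ₗ []       = no λ ()
  (A ∷ As) ≟ₗ (B ∷ Bs) with A ≟ₛ B | As ≟ₗ Bs
  ... | yes refl | yes refl = yes refl
  ... | no A≢B   | _        = no λ { refl → A≢B refl }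
  ... | _        | no As≢Bs = no λ { refl → As≢Bs refl }

-- Q L₀ X Y: the string L₀ X Y ⋯ is cut between X and Y.
CutCondition : Set₁
CutCondition = List Sym → Sym → Sym → Set

BoundaryRule : (ℕ → Set) → CutCondition → List Sym → Set
BoundaryRule Bd Q T = ∀ L₀ X Y L₄ → T ≡ L₀ ++ X ∷ Y ∷ L₄ → Bd (suc (length L₀)) ⇔ Q L₀ X Y

Cut : CutCondition → List Sym → List Sym → Set
Cut Q L₁ L₂ = Σ (List Sym) λ L₀ → Σ Sym λ X → Σ Sym λ Y → Σ (List Sym) λ L₄ →
  L₁ ≡ L₀ ∷ʳ X × L₂ ≡ Y ∷ L₄ × Q L₀ X Y

CutAt : CutCondition → List Sym → ℕ → Set
CutAt Q T p = Σ (List Sym) λ L₁ → Σ (List Sym) λ L₂ → T ≡ L₁ ++ L₂ × ∥ L₁ ∥ ≡ p × (L₁ ≡ [] ⊎ L₂ ≡ [] ⊎ Cut Q L₁ L₂)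

PreservesExpansion : (List Sym → Sym) → List (List Sym) → Set
PreservesExpansion mk = All (λ b → expS (mk b) ≡ expL b)

expL-map : ∀ mk bs → PreservesExpansion mk bs → expL (map mk bs) ≡ expL (concat bs)
expL-map mk []       []       = refl
expL-map mk (b ∷ bs) (e ∷ es) = trans (cong₂ _++_ e (expL-map mk bs es)) (sym (expL-++ b (concat bs)))

∥map∥ : ∀ mk bs → PreservesExpansion mk bs → ∥ map mk bs ∥ ≡ ∥ concat bs ∥
∥map∥ mk bs me = cong length (expL-map mk bs me)

module _ {mk : List Sym → Sym} {Bd : ℕ → Set} {Q : CutCondition} {T : List Sym} {bs : List (List Sym)}
         (grouping : Grouping T Bd bs) (me : PreservesExpansion mk bs) (rule : BoundaryRule Bd Q T) where

  private
    concat-bs : concat bs ≡ T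
    concat-bs = proj₁ (proj₂ grouping)
    cuts : ∀ i → 1 ≤ i → i < length T → (Bd i ⇔ IsCut bs i)
    cuts = proj₂ (proj₂ grouping)

    classify : ∀ L₁ L₂ → T ≡ L₁ ++ L₂ → (1 ≤ length L₁ → length L₁ < length T → Bd (length L₁)) →
      L₁ ≡ [] ⊎ L₂ ≡ [] ⊎ Cut Q L₁ L₂
    classify L₁ []       _ _ = inj₂ (inj₁ refl)
    classify L₁ (Y ∷ L₄) e bd with initLast L₁
    ... | []       = inj₁ refl
    ... | L₀ ∷ʳ′ X = inj₂ (inj₂ (L₀ , X , Y , L₄ , refl , refl , Equivalence.to (rule L₀ X Y L₄ T≡) bd′))
      where
      T≡ : T ≡ L₀ ++ X ∷ Y ∷ L₄
      T≡ = trans e (∷ʳ-++-∷ L₀ X (Y ∷ L₄))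
      bd′ : Bd (suc (length L₀))
      bd′ = subst Bd (length-∷ʳ L₀ X)
              (bd (subst (1 ≤_) (sym (length-∷ʳ L₀ X)) (s≤s z≤n))
                  (subst (λ t → length (L₀ ∷ʳ X) < length t) (sym e) (length-<-++-∷ (L₀ ∷ʳ X) Y L₄)))

  boundary⇒cutAt : ∀ {p} → Boundary (map mk bs) p → CutAt Q T p
  boundary⇒cutAt {p} (U , V , e , a) with map-++-inv mk bs U V e
  ... | b₁ , b₂ , refl , refl , refl = concat b₁ , concat b₂ , T≡ , len , classify (concat b₁) (concat b₂) T≡ isCut
    where
    T≡ : T ≡ concat b₁ ++ concat b₂
    T≡ = trans (sym concat-bs) (sym (concat-++ b₁ b₂))
    len : ∥ concat b₁ ∥ ≡ p
    len = trans (sym (∥map∥ mk b₁ (All.++⁻ˡ b₁ me))) a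
    isCut : 1 ≤ length (concat b₁) → length (concat b₁) < length T → Bd (length (concat b₁))
    isCut ge lt = Equivalence.from (cuts _ ge lt) (length b₁ , cong (λ b → length (concat b)) (take-length-++ b₁ b₂))

  cutAt⇒boundary : ∀ {p} → CutAt Q T p → Boundary (map mk bs) p
  cutAt⇒boundary (L₁ , L₂ , e , a , inj₁ refl) = [] , map mk bs , refl , a
  cutAt⇒boundary (L₁ , L₂ , e , a , inj₂ (inj₁ refl)) =
    map mk bs , [] , sym (++-identityʳ _) ,
    trans (∥map∥ mk bs me) (trans (cong ∥_∥ (trans concat-bs e)) (trans (cong ∥_∥ (++-identityʳ L₁)) a))
  cutAt⇒boundary (L₁ , L₂ , e , a , inj₂ (inj₂ (L₀ , X , Y , L₄ , refl , refl , q)))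
    with Equivalence.to (cuts _ ge lt) bd
    where
    T≡ : T ≡ L₀ ++ X ∷ Y ∷ L₄
    T≡ = trans e (∷ʳ-++-∷ L₀ X (Y ∷ L₄))
    ge : 1 ≤ length (L₀ ∷ʳ X)
    ge = subst (1 ≤_) (sym (length-∷ʳ L₀ X)) (s≤s z≤n)
    lt : length (L₀ ∷ʳ X) < length T
    lt = subst (λ t → length (L₀ ∷ʳ X) < length t) (sym e) (length-<-++-∷ (L₀ ∷ʳ X) Y L₄)
    bd : Bd (length (L₀ ∷ʳ X))
    bd = subst Bd (sym (length-∷ʳ L₀ X)) (Equivalence.from (rule L₀ X Y L₄ T≡) q)
  ... | j , lj with ++-cancel-length (concat (take j bs)) (concat (drop j bs)) (L₀ ∷ʳ X) (Y ∷ L₄) split lj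
    where
    split : concat (take j bs) ++ concat (drop j bs) ≡ (L₀ ∷ʳ X) ++ Y ∷ L₄
    split = trans (concat-++ (take j bs) (drop j bs)) (trans (cong concat (take++drop≡id j bs)) (trans concat-bs e))
  ... | e₁ , _ = map mk (take j bs) , map mk (drop j bs) ,
      trans (cong (map mk) (sym (take++drop≡id j bs))) (map-++ mk (take j bs) (drop j bs)) ,
      trans (∥map∥ mk (take j bs) me-take) (trans (cong ∥_∥ e₁) a)
    where
    me-take : PreservesExpansion mk (take j bs)
    me-take = All.++⁻ˡ (take j bs) (subst (PreservesExpansion mk) (sym (take++drop≡id j bs)) me)

Adjacent : (ℕ → Sym → Sym → Set) → List Sym → ℕ → Set
Adjacent P T i = Σ Sym λ A → Σ Sym λ B → get T i ≡ just A × get T (suc i) ≡ just B × P i A B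

adjacentRule : ∀ {T} P {Q} → (∀ L₀ X Y L₄ → T ≡ L₀ ++ X ∷ Y ∷ L₄ → P (suc (length L₀)) X Y ⇔ Q L₀ X Y) →
  BoundaryRule (Adjacent P T) Q T
adjacentRule P {Q} P⇔Q L₀ X Y L₄ refl = mk⇔ to from
  where
  gX : get (L₀ ++ X ∷ Y ∷ L₄) (suc (length L₀)) ≡ just X
  gX = get-suc-length-++ L₀ X (Y ∷ L₄)
  gY : get (L₀ ++ X ∷ Y ∷ L₄) (suc (suc (length L₀))) ≡ just Y
  gY = get-suc-suc-length-++ L₀ X Y L₄
  to : Adjacent P (L₀ ++ X ∷ Y ∷ L₄) (suc (length L₀)) → Q L₀ X Y
  to (A , B , gA , gB , p) with just-injective (trans (sym gA) gX) | just-injective (trans (sym gB) gY)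
  ... | refl | refl = Equivalence.to (P⇔Q L₀ X Y L₄ refl) p
  from : Q L₀ X Y → Adjacent P (L₀ ++ X ∷ Y ∷ L₄) (suc (length L₀))
  from q = X , Y , gX , gY , Equivalence.from (P⇔Q L₀ X Y L₄ refl) q

OddCut : ℕ → CutCondition
OddCut k _ X Y = ¬ InA k X ⊎ ¬ InA k Y ⊎ X ≢ Y

oddRule : ∀ k T → BoundaryRule (OddBd k T) (OddCut k) T
oddRule k T = adjacentRule (λ _ A B → ¬ InA k A ⊎ ¬ InA k B ⊎ A ≢ B) (λ _ _ _ _ _ → ⇔.refl)

LocalMinAfter : (Sym → ℕ) → CutCondition
LocalMinAfter π L₀ X Y = Σ (List Sym) λ L₀₀ → Σ Sym λ W → L₀ ≡ L₀₀ ∷ʳ W × π W > π X × π X < π Y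

EvenCut : ℕ → (Sym → ℕ) → CutCondition
EvenCut k π L₀ X Y = ¬ InA k X ⊎ ¬ InA k Y ⊎ LocalMinAfter π L₀ X Y

locMin⇔ : ∀ π L₀ X Y L₄ → LocMin π (L₀ ++ X ∷ Y ∷ L₄) (suc (length L₀)) ⇔ LocalMinAfter π L₀ X Y
locMin⇔ π L₀ X Y L₄ with initLast L₀
... | [] = mk⇔ (λ { (s≤s () , _) }) (λ { ([] , _ , () , _) ; (_ ∷ _ , _ , () , _) })
... | L₀₀ ∷ʳ′ W = mk⇔ to from
  where
  T≡ : (L₀₀ ∷ʳ W) ++ X ∷ Y ∷ L₄ ≡ L₀₀ ++ W ∷ X ∷ Y ∷ L₄
  T≡ = ∷ʳ-++-∷ L₀₀ W (X ∷ Y ∷ L₄)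
  i≡ : suc (length (L₀₀ ∷ʳ W)) ≡ suc (suc (length L₀₀))
  i≡ = cong suc (length-∷ʳ L₀₀ W)
  gW : get ((L₀₀ ∷ʳ W) ++ X ∷ Y ∷ L₄) (suc (length (L₀₀ ∷ʳ W)) ∸ 1) ≡ just W
  gW = subst₂ (λ t i → get t (i ∸ 1) ≡ just W) (sym T≡) (sym i≡) (get-suc-length-++ L₀₀ W _)
  gX : get ((L₀₀ ∷ʳ W) ++ X ∷ Y ∷ L₄) (suc (length (L₀₀ ∷ʳ W))) ≡ just X
  gX = get-suc-length-++ (L₀₀ ∷ʳ W) X (Y ∷ L₄)
  gY : get ((L₀₀ ∷ʳ W) ++ X ∷ Y ∷ L₄) (suc (suc (length (L₀₀ ∷ʳ W)))) ≡ just Y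
  gY = get-suc-suc-length-++ (L₀₀ ∷ʳ W) X Y L₄
  to : LocMin π ((L₀₀ ∷ʳ W) ++ X ∷ Y ∷ L₄) (suc (length (L₀₀ ∷ʳ W))) → LocalMinAfter π (L₀₀ ∷ʳ W) X Y
  to (_ , C , A , B , gC , gA , gB , πC>πA , πA<πB)
    with just-injective (trans (sym gC) gW) | just-injective (trans (sym gA) gX) | just-injective (trans (sym gB) gY)
  ... | refl | refl | refl = L₀₀ , W , refl , πC>πA , πA<πB
  from : LocalMinAfter π (L₀₀ ∷ʳ W) X Y → LocMin π ((L₀₀ ∷ʳ W) ++ X ∷ Y ∷ L₄) (suc (length (L₀₀ ∷ʳ W)))
  from (M₀₀ , W′ , e , πW>πX , πX<πY) with ∷ʳ-injective L₀₀ M₀₀ e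
  ... | refl , refl = subst (1 <_) (sym i≡) (s≤s (s≤s z≤n)) , W , X , Y , gW , gX , gY , πW>πX , πX<πY

evenRule : ∀ k π T → BoundaryRule (EvenBd k π T) (EvenCut k π) T
evenRule k π T = adjacentRule (λ i A B → ¬ InA k A ⊎ ¬ InA k B ⊎ LocMin π T i) rule
  where
  rule : ∀ L₀ X Y L₄ → T ≡ L₀ ++ X ∷ Y ∷ L₄ →
    (¬ InA k X ⊎ ¬ InA k Y ⊎ LocMin π T (suc (length L₀))) ⇔ EvenCut k π L₀ X Y
  rule L₀ X Y L₄ refl = mk⇔ (Sum.map₂ (Sum.map₂ (Equivalence.to (locMin⇔ π L₀ X Y L₄))))
                             (Sum.map₂ (Sum.map₂ (Equivalence.from (locMin⇔ π L₀ X Y L₄))))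

interior-not-cut : ∀ b₁ (b : List Sym) b₂ j i → 0 < i → i < length b →
  length (concat (take j (b₁ ++ b ∷ b₂))) ≢ length (concat b₁) + i
interior-not-cut []       b b₂ zero    i 0<i _ e = <-irrefl e 0<i
interior-not-cut []       b b₂ (suc j) i _ i<b e =
  <⇒≱ i<b (subst (length b ≤_) (trans (sym (length-++ b)) e) (m≤m+n _ _))
interior-not-cut (c ∷ b₁) b b₂ zero    i 0<i _ e = <-irrefl e (<-≤-trans 0<i (m≤n+m i _))
interior-not-cut (c ∷ b₁) b b₂ (suc j) i 0<i i<b e =
  interior-not-cut b₁ b b₂ j i 0<i i<b (+-cancelˡ-≡ (length c) _ _
    (trans (sym (length-++ c)) (trans e (trans (cong (_+ i) (length-++ c)) (+-assoc (length c) _ i)))))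

within-block : ∀ {T Bd bs} → Grouping T Bd bs → ∀ b₁ b b₂ → bs ≡ b₁ ++ b ∷ b₂ →
  ∀ P X Y R → b ≡ P ++ X ∷ Y ∷ R →
  T ≡ (concat b₁ ++ P) ++ X ∷ Y ∷ (R ++ concat b₂) × ¬ Bd (suc (length (concat b₁ ++ P)))
within-block {T} {Bd} {bs} (_ , concat-bs , cuts) b₁ b b₂ refl P X Y R refl = T≡ , notCut
  where
  open ≡-Reasoning
  T≡ : T ≡ (concat b₁ ++ P) ++ X ∷ Y ∷ (R ++ concat b₂)
  T≡ = begin
    T                                               ≡⟨ concat-bs ⟨
    concat (b₁ ++ (P ++ X ∷ Y ∷ R) ∷ b₂)           ≡⟨ concat-++ b₁ _ ⟨
    concat b₁ ++ (P ++ X ∷ Y ∷ R) ++ concat b₂     ≡⟨ cong (concat b₁ ++_) (++-assoc P (X ∷ Y ∷ R) (concat b₂)) ⟩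
    concat b₁ ++ P ++ X ∷ Y ∷ (R ++ concat b₂)     ≡⟨ ++-assoc (concat b₁) P _ ⟨
    (concat b₁ ++ P) ++ X ∷ Y ∷ (R ++ concat b₂)   ∎
  i : ℕ
  i = suc (length (concat b₁ ++ P))
  i<T : i < length T
  i<T = subst (λ t → i < length t) (sym T≡) (suc-length-<-++-∷-∷ (concat b₁ ++ P) X Y _)
  notCut : ¬ Bd i
  notCut bd with Equivalence.to (cuts i (s≤s z≤n) i<T) bd
  ... | j , lj = interior-not-cut b₁ (P ++ X ∷ Y ∷ R) b₂ j (suc (length P)) (s≤s z≤n)
                   (suc-length-<-++-∷-∷ P X Y R)
                   (trans lj (trans (cong suc (length-++ (concat b₁))) (sym (+-suc _ _))))

expL-constant : ∀ A L → All (_≡ A) L → expL L ≡ rep (length L) (expS A)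
expL-constant A []      []           = refl
expL-constant A (B ∷ L) (refl ∷ L≡A) = cong (expS B ++_) (expL-constant A L L≡A)

constant-if-adjacent-equal : ∀ A (b : List Sym) → (∀ P X Y R → A ∷ b ≡ P ++ X ∷ Y ∷ R → X ≡ Y) → All (_≡ A) (A ∷ b)
constant-if-adjacent-equal A []      _  = refl ∷ []
constant-if-adjacent-equal A (B ∷ b) eq with eq [] A B b refl
... | refl = refl ∷ constant-if-adjacent-equal A b (λ P X Y R e → eq (A ∷ P) X Y R (cong (A ∷_) e))

mkRun-preservesExpansion : ∀ {k T bs} → Grouping T (OddBd k T) bs → PreservesExpansion mkRun bs
mkRun-preservesExpansion {k} {T} {bs} G@(nonEmpty , _ , _) = go [] bs refl
  where
  go : ∀ b₁ b₂ → bs ≡ b₁ ++ b₂ → PreservesExpansion mkRun b₂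
  go b₁ []       _ = []
  go b₁ (b ∷ b₂) e = block (All.head (All.++⁻ʳ b₁ (subst (All NonEmpty) e nonEmpty)))
                   ∷ go (b₁ ∷ʳ b) b₂ (trans e (sym (∷ʳ-++-∷ b₁ b b₂)))
    where
    block : NonEmpty b → expS (mkRun b) ≡ expL b
    block (A , []    , refl) = sym (++-identityʳ _)
    block (A , B ∷ r , refl) = trans (cong (λ m → rep m (expS A)) (+-comm (length r) 2))
                                     (sym (expL-constant A (A ∷ B ∷ r) (constant-if-adjacent-equal A (B ∷ r) equal)))
      where
      equal : ∀ P X Y R → A ∷ B ∷ r ≡ P ++ X ∷ Y ∷ R → X ≡ Y
      equal P X Y R eb with within-block G b₁ (A ∷ B ∷ r) b₂ e P X Y R eb
      ... | T≡ , notCut = decidable-stable (X ≟ₛ Y)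
            (λ X≢Y → notCut (Equivalence.from (oddRule k T _ X Y _ T≡) (inj₂ (inj₂ X≢Y))))

mkBlk-preservesExpansion : ∀ bs → All NonEmpty bs → PreservesExpansion mkBlk bs
mkBlk-preservesExpansion []       []                         = []
mkBlk-preservesExpansion (b ∷ bs) ((_ , [] , refl) ∷ ne)     = sym (++-identityʳ _) ∷ mkBlk-preservesExpansion bs ne
mkBlk-preservesExpansion (b ∷ bs) ((_ , _ ∷ _ , refl) ∷ ne)  = refl ∷ mkBlk-preservesExpansion bs ne

positive-map : ∀ mk bs → PreservesExpansion mk bs → All NonEmpty bs → Positive (concat bs) → Positive (map mk bs)
positive-map mk []       []       []                     _ = []
positive-map mk (b ∷ bs) (e ∷ es) ((A , L , refl) ∷ ne) p =
  subst (0 <_) (sym (cong length e)) (∥∥-positive A L (All.++⁻ˡ b p)) ∷ positive-map mk bs es ne (All.++⁻ʳ b p)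

expL-map-leaf : ∀ S → expL (map leaf S) ≡ S
expL-map-leaf []      = refl
expL-map-leaf (a ∷ S) = cong (a ∷_) (expL-map-leaf S)

positive-map-leaf : ∀ S → Positive (map leaf S)
positive-map-leaf []      = []
positive-map-leaf (a ∷ S) = s≤s z≤n ∷ positive-map-leaf S

data StepKind (k : ℕ) (T T′ : List Sym) : Set where
  odd  : OddStep k T T′ → StepKind k T T′
  even : EvenStep k T T′ → StepKind k T T′

stepKind : ∀ k {T T′} → Step k T T′ → StepKind k T T′
stepKind k st with isOdd k
... | true  = odd st
... | false = even st

level-expands : ∀ {S k T} → Level S k T → expL T ≡ S × Positive T
level-expands {S} lvl0 = expL-map-leaf S , positive-map-leaf S
level-expands (lvlS {k} lv st) with level-expands lv | stepKind (suc k) st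
... | T≡S , pT | odd (bs , G@(ne , concat-bs , _) , refl) =
  trans (expL-map mkRun bs me) (trans (cong expL concat-bs) T≡S) ,
  positive-map mkRun bs me ne (subst Positive (sym concat-bs) pT)
  where
  me : PreservesExpansion mkRun bs
  me = mkRun-preservesExpansion {suc k} G
... | T≡S , pT | even (π , _ , bs , G@(ne , concat-bs , _) , refl) =
  trans (expL-map mkBlk bs me) (trans (cong expL concat-bs) T≡S) ,
  positive-map mkBlk bs me ne (subst Positive (sym concat-bs) pT)
  where
  me : PreservesExpansion mkBlk bs
  me = mkBlk-preservesExpansion bs ne

∥∥-level : ∀ {S k T} → Level S k T → ∥ T ∥ ≡ length S
∥∥-level lv = cong length (proj₁ (level-expands lv))

-- Radii

-- ⌊ℓ_{k+1}⌋ (note the index shift)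
floorℓ-suc : ℕ → ℕ
floorℓ-suc k = 4 ^ ⌊ k /2⌋ / 3 ^ ⌊ k /2⌋
  where instance _ = m^n≢0 3 ⌊ k /2⌋

radius : ℕ → ℕ
radius zero    = 0
radius (suc k) = radius k + floorℓ-suc k

floorℓ-suc≥1 : ∀ k → 1 ≤ floorℓ-suc k
floorℓ-suc≥1 k = subst (_≤ floorℓ-suc k) (n/n≡1 (3 ^ t)) (/-monoˡ-≤ (3 ^ t) (^-monoˡ-≤ t (n≤1+n 3)))
  where
  t : ℕ
  t = ⌊ k /2⌋
  instance _ = m^n≢0 3 t

InA⇒∣∣≤floorℓ-suc : ∀ k A → InA (suc k) A → ∣ A ∣ ≤ floorℓ-suc k
InA⇒∣∣≤floorℓ-suc k A A∈𝒜 = subst (_≤ floorℓ-suc k) (m*n/n≡m ∣ A ∣ (3 ^ t)) (/-monoˡ-≤ (3 ^ t) A∈𝒜)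
  where
  t : ℕ
  t = ⌊ k /2⌋
  instance _ = m^n≢0 3 t

floorℓ-suc*3^≤4^ : ∀ k s → ⌊ k /2⌋ ≤ s → floorℓ-suc k * 3 ^ s ≤ 4 ^ s
floorℓ-suc*3^≤4^ k s t≤s = begin
  floorℓ-suc k * 3 ^ s               ≡⟨ cong (λ u → floorℓ-suc k * 3 ^ u) (m+[n∸m]≡n t≤s) ⟨
  floorℓ-suc k * 3 ^ (t + d)         ≡⟨ cong (floorℓ-suc k *_) (^-distribˡ-+-* 3 t d) ⟩
  floorℓ-suc k * (3 ^ t * 3 ^ d)     ≡⟨ *-assoc (floorℓ-suc k) (3 ^ t) (3 ^ d) ⟨
  floorℓ-suc k * 3 ^ t * 3 ^ d       ≤⟨ *-mono-≤ (m/n*n≤m (4 ^ t) (3 ^ t)) (^-monoˡ-≤ d (n≤1+n 3)) ⟩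
  4 ^ t * 4 ^ d                      ≡⟨ ^-distribˡ-+-* 4 t d ⟨
  4 ^ (t + d)                        ≡⟨ cong (4 ^_) (m+[n∸m]≡n t≤s) ⟩
  4 ^ s                              ∎
  where
  open ≤-Reasoning
  t d : ℕ
  t = ⌊ k /2⌋
  d = s ∸ t
  instance _ = m^n≢0 3 t

-- radius (k + 1) + 6 ≤ 8 ℓ_{k+1}, multiplied by 3^⌊k/2⌋: the radii are partial sums of a
-- geometric series whose ratio is 4/3 every two levels.
radius-suc-bound : ∀ k → radius (suc k) * 3 ^ ⌊ k /2⌋ + 6 * 3 ^ ⌊ k /2⌋ ≤ 8 * 4 ^ ⌊ k /2⌋
radius-suc-bound zero          = s≤s (s≤s (s≤s (s≤s (s≤s (s≤s (s≤s z≤n))))))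
radius-suc-bound (suc zero)    = ≤-refl
radius-suc-bound (suc (suc k)) = begin
  (a + b + c) * (3 * B) + 6 * (3 * B)                ≡⟨ regroup a b c B ⟩
  3 * (a * B + 6 * B) + (b * (3 * B) + c * (3 * B))  ≤⟨ +-mono-≤ (*-monoʳ-≤ 3 (radius-suc-bound k)) (+-mono-≤ b-bound c-bound) ⟩
  3 * (8 * C) + (4 * C + 4 * C)                      ≡⟨ collect C ⟩
  8 * (4 * C)                                        ∎
  where
  open ≤-Reasoning
  t a b c B C : ℕ
  t = ⌊ k /2⌋
  a = radius (suc k)
  b = floorℓ-suc (suc k)
  c = floorℓ-suc (suc (suc k))
  B = 3 ^ t
  C = 4 ^ t
  regroup : ∀ a b c B → (a + b + c) * (3 * B) + 6 * (3 * B) ≡ 3 * (a * B + 6 * B) + (b * (3 * B) + c * (3 * B))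
  regroup = solve-∀
  collect : ∀ C → 3 * (8 * C) + (4 * C + 4 * C) ≡ 8 * (4 * C)
  collect = solve-∀
  b-bound : b * (3 * B) ≤ 4 * C
  b-bound = floorℓ-suc*3^≤4^ (suc k) (suc t) (⌊n/2⌋-mono (n≤1+n (suc k)))
  c-bound : c * (3 * B) ≤ 4 * C
  c-bound = floorℓ-suc*3^≤4^ (suc (suc k)) (suc t) ≤-refl

radius≤floor8ℓ : ∀ k → radius k ≤ floor8ℓ k
radius≤floor8ℓ zero    = z≤n
radius≤floor8ℓ (suc k) = subst (_≤ floor8ℓ (suc k)) (m*n/n≡m (radius (suc k)) (3 ^ t))
  (/-monoˡ-≤ (3 ^ t) (m+n≤o⇒m≤o _ (radius-suc-bound k)))
  where
  t : ℕ
  t = ⌊ k /2⌋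
  instance _ = m^n≢0 3 t

-- Transfer between agreeing windows

Window : List ℕ → ℕ → ℕ → ℕ → Set
Window S c c′ len = c + len ≤ length S × c′ + len ≤ length S × take len (drop c S) ≡ take len (drop c′ S)

window-sym : ∀ {S c c′ len} → Window S c c′ len → Window S c′ c len
window-sym (c+len≤ , c′+len≤ , agree) = c′+len≤ , c+len≤ , sym agree

window-fits : ∀ {S k T c c′ len} → Level S k T → Window S c c′ len → c + len ≤ ∥ T ∥
window-fits {c = c} {len = len} lv w = subst (c + len ≤_) (sym (∥∥-level lv)) (proj₁ w)

window-subword : ∀ {S c c′ len} → Window S c c′ len → ∀ s m → s + m ≤ len →
  take m (drop (c + s) S) ≡ take m (drop (c′ + s) S)
window-subword {S} {c} {c′} {len} (_ , _ , agree) s m s+m≤len = begin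
  take m (drop (c + s) S)                          ≡⟨ take-drop-+ S c s m ⟩
  drop s (take (s + m) (drop c S))                 ≡⟨ cong (drop s) (shorten c) ⟨
  drop s (take (s + m) (take len (drop c S)))      ≡⟨ cong (λ w → drop s (take (s + m) w)) agree ⟩
  drop s (take (s + m) (take len (drop c′ S)))     ≡⟨ cong (drop s) (shorten c′) ⟩
  drop s (take (s + m) (drop c′ S))                ≡⟨ take-drop-+ S c′ s m ⟨
  take m (drop (c′ + s) S)                         ∎
  where
  open ≡-Reasoning
  shorten : ∀ d → take (s + m) (take len (drop d S)) ≡ take (s + m) (drop d S)
  shorten d = trans (take-take (s + m) len (drop d S)) (cong (λ w → take w (drop d S)) (m≤n⇒m⊓n≡m s+m≤len))

-- The left margin is twice the right one: at even levels a cut also depends on the symbol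
-- two positions to its left.
SegmentsTransfer : List Sym → ℕ → ℕ → ℕ → ℕ → Set
SegmentsTransfer T r c c′ len = ∀ s t L → r + r ≤ s → s ≤ t → t + r ≤ len →
  Segment T (c + s) (c + t) L → Segment T (c′ + s) (c′ + t) L

BoundariesTransfer : List Sym → ℕ → ℕ → ℕ → ℕ → Set
BoundariesTransfer T r c c′ len = ∀ s → r + r ≤ s → s + r ≤ len → Boundary T (c + s) → Boundary T (c′ + s)

segments⇒boundaries : ∀ {T r c c′ len} → SegmentsTransfer T r c c′ len → BoundariesTransfer T r c c′ len
segments⇒boundaries sg s 2r≤s s+r≤len bd = segment-start (sg s s [] 2r≤s ≤-refl s+r≤len (boundary⇒segment-[] bd))

∥map-leaf∥ : ∀ S → ∥ map leaf S ∥ ≡ length S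
∥map-leaf∥ S = cong length (expL-map-leaf S)

leaf-segment : ∀ {S x y L} → Segment (map leaf S) x y L → L ≡ map leaf (take (y ∸ x) (drop x S))
leaf-segment {S} {x} {y} (L₁ , L₂ , e , a , b) with map-++-inv leaf S L₁ _ e
... | S₁ , S₂₃ , refl , refl , e₂₃ with map-++-inv leaf S₂₃ _ L₂ (sym e₂₃)
... | S₂ , S₃ , refl , refl , refl = cong (map leaf) (sym (begin
  take (y ∸ x) (drop x (S₁ ++ S₂ ++ S₃))              ≡⟨ cong₂ (λ m d → take m (drop d (S₁ ++ S₂ ++ S₃))) y∸x x≡ ⟩
  take (length S₂) (drop (length S₁) (S₁ ++ S₂ ++ S₃)) ≡⟨ cong (take (length S₂)) (drop-length-++ S₁ (S₂ ++ S₃)) ⟩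
  take (length S₂) (S₂ ++ S₃)                          ≡⟨ take-length-++ S₂ S₃ ⟩
  S₂                                                   ∎))
  where
  open ≡-Reasoning
  x≡ : x ≡ length S₁
  x≡ = trans (sym a) (∥map-leaf∥ S₁)
  y∸x : y ∸ x ≡ length S₂
  y∸x = trans (cong (_∸ x) (sym b)) (trans (m+n∸m≡n x _) (∥map-leaf∥ S₂))

leaf-segment-intro : ∀ S x y → x ≤ y → y ≤ length S →
  Segment (map leaf S) x y (map leaf (take (y ∸ x) (drop x S)))
leaf-segment-intro S x y x≤y y≤S = map leaf (take x S) , map leaf (drop m D) , S≡ , a , b
  where
  open ≡-Reasoning
  m : ℕ
  m = y ∸ x
  D : List ℕ
  D = drop x S
  x≤S : x ≤ length S
  x≤S = ≤-trans x≤y y≤S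
  m≤D : m ≤ length D
  m≤D = subst (m ≤_) (sym (length-drop x S)) (∸-monoˡ-≤ x y≤S)
  S≡ : map leaf S ≡ map leaf (take x S) ++ (map leaf (take m D) ++ map leaf (drop m D))
  S≡ = begin
    map leaf S                                           ≡⟨ cong (map leaf) (take++drop≡id x S) ⟨
    map leaf (take x S ++ D)                             ≡⟨ map-++ leaf (take x S) D ⟩
    map leaf (take x S) ++ map leaf D                    ≡⟨ cong (λ w → map leaf (take x S) ++ map leaf w) (take++drop≡id m D) ⟨
    map leaf (take x S) ++ map leaf (take m D ++ drop m D) ≡⟨ cong (map leaf (take x S) ++_) (map-++ leaf (take m D) (drop m D)) ⟩
    map leaf (take x S) ++ (map leaf (take m D) ++ map leaf (drop m D)) ∎
  a : ∥ map leaf (take x S) ∥ ≡ x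
  a = trans (∥map-leaf∥ (take x S)) (length-take-≤ x S x≤S)
  b : x + ∥ map leaf (take m D) ∥ ≡ y
  b = trans (cong (x +_) (trans (∥map-leaf∥ (take m D)) (length-take-≤ m D m≤D))) (m+[n∸m]≡n x≤y)

leaves-transfer : ∀ {S c c′ len} → Window S c c′ len → SegmentsTransfer (map leaf S) 0 c c′ len
leaves-transfer {S} {c} {c′} {len} w@(_ , c′+len≤ , _) s t L _ s≤t t+0≤len sg =
  subst (Segment (map leaf S) (c′ + s) (c′ + t)) (sym L≡) (leaf-segment-intro S (c′ + s) (c′ + t) (+-monoʳ-≤ c′ s≤t) c′+t≤S)
  where
  t≤len : t ≤ len
  t≤len = subst (_≤ len) (+-identityʳ t) t+0≤len
  c′+t≤S : c′ + t ≤ length S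
  c′+t≤S = ≤-trans (+-monoʳ-≤ c′ t≤len) c′+len≤
  L≡ : L ≡ map leaf (take ((c′ + t) ∸ (c′ + s)) (drop (c′ + s) S))
  L≡ = begin
    L                                                     ≡⟨ leaf-segment sg ⟩
    map leaf (take ((c + t) ∸ (c + s)) (drop (c + s) S))  ≡⟨ cong (λ m → map leaf (take m (drop (c + s) S))) ([m+n]∸[m+o]≡n∸o c t s) ⟩
    map leaf (take (t ∸ s) (drop (c + s) S))              ≡⟨ cong (map leaf) (window-subword w s (t ∸ s) (subst (_≤ len) (sym (m+[n∸m]≡n s≤t)) t≤len)) ⟩
    map leaf (take (t ∸ s) (drop (c′ + s) S))             ≡⟨ cong (λ m → map leaf (take m (drop (c′ + s) S))) ([m+n]∸[m+o]≡n∸o c′ t s) ⟨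
    map leaf (take ((c′ + t) ∸ (c′ + s)) (drop (c′ + s) S)) ∎
    where open ≡-Reasoning

phrase-ending-transfer : ∀ {T R c c′ len} → SegmentsTransfer T R c c′ len → ∀ u {x A} → Phrase T x (c + u) A →
  R + R + ∣ A ∣ ≤ u → u + R ≤ len → Phrase T (c′ + (u ∸ ∣ A ∣)) (c′ + u) A
phrase-ending-transfer {T} {R} {c} sg u {x} {A} ph h₁ h₂ =
  sg (u ∸ ∣ A ∣) u (A ∷ []) (m+n≤o⇒m≤o∸n (R + R) h₁) (m∸n≤m u ∣ A ∣) h₂ (subst (λ z → Phrase T z (c + u) A) x≡ ph)
  where
  x≡ : x ≡ c + (u ∸ ∣ A ∣)
  x≡ = +≡⇒≡+∸ (phrase-length ph) (≤-trans (m≤n+m ∣ A ∣ (R + R)) h₁)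

phrase-starting-transfer : ∀ {T R c c′ len} → SegmentsTransfer T R c c′ len → ∀ u {y A} → Phrase T (c + u) y A →
  R + R ≤ u → u + ∣ A ∣ + R ≤ len → Phrase T (c′ + u) (c′ + (u + ∣ A ∣)) A
phrase-starting-transfer {T} {R} {c} sg u {y} {A} ph h₁ h₂ =
  sg u (u + ∣ A ∣) (A ∷ []) h₁ (m≤m+n u ∣ A ∣) h₂ (subst (λ z → Phrase T (c + u) z A) y≡ ph)
  where
  y≡ : y ≡ c + (u + ∣ A ∣)
  y≡ = trans (sym (phrase-length ph)) (+-assoc c u ∣ A ∣)

InA? : ∀ k A → Dec (InA k A)
InA? k A = _ ≤? _

oddCut-stable : ∀ {k L₀ X Y M₀ X′ Y′} → (InA k X′ → X ≡ X′) → (InA k Y′ → Y ≡ Y′) →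
  OddCut k L₀ X Y → OddCut k M₀ X′ Y′
oddCut-stable {k} {X′ = X′} {Y′} left right q with InA? k X′ | InA? k Y′
... | no X′∉𝒜  | _         = inj₁ X′∉𝒜
... | yes _    | no Y′∉𝒜  = inj₂ (inj₁ Y′∉𝒜)
... | yes X′∈𝒜 | yes Y′∈𝒜 with left X′∈𝒜 | right Y′∈𝒜
... | refl | refl = q

locMin-left∈𝒜 : ∀ {k T π W X} → ValidPerm k T π → W ∈ T → X ∈ T → π W > π X → InA k X → InA k W
locMin-left∈𝒜 {k} {W = W} (_ , _ , π-𝒜-last) W∈T X∈T πW>πX X∈𝒜 =
  decidable-stable (InA? k W) (λ W∉𝒜 → <-asym (π-𝒜-last _ _ W∈T X∈T W∉𝒜 X∈𝒜) πW>πX)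

evenCut-stable : ∀ {k π L₀ X Y M₀ X′ Y′} → (InA k X′ → X ≡ X′) → (InA k Y′ → Y ≡ Y′) →
  (∀ {L₀₀ W} → L₀ ≡ L₀₀ ∷ʳ W → π W > π X → InA k X → X ≡ X′ → Σ (List Sym) λ M₀₀ → M₀ ≡ M₀₀ ∷ʳ W) →
  EvenCut k π L₀ X Y → EvenCut k π M₀ X′ Y′
evenCut-stable {k} {X′ = X′} {Y′} left right second q with InA? k X′ | InA? k Y′
... | no X′∉𝒜 | _         = inj₁ X′∉𝒜
... | yes _   | no Y′∉𝒜  = inj₂ (inj₁ Y′∉𝒜)
... | yes X∈𝒜 | yes Y∈𝒜 with left X∈𝒜 | right Y∈𝒜
... | refl | refl with q
... | inj₁ X∉𝒜        = ⊥-elim (X∉𝒜 X∈𝒜)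
... | inj₂ (inj₁ Y∉𝒜) = ⊥-elim (Y∉𝒜 Y∈𝒜)
... | inj₂ (inj₂ (L₀₀ , W , L₀≡ , πW>πX , πX<πY)) with second L₀≡ πW>πX X∈𝒜 refl
... | M₀₀ , M₀≡ = inj₂ (inj₂ (M₀₀ , W , M₀≡ , πW>πX , πX<πY))

CutsTransfer : CutCondition → List Sym → ℕ → ℕ → ℕ → ℕ → Set
CutsTransfer Q T r c c′ len = ∀ s → r + r ≤ s → s + r ≤ len → CutAt Q T (c + s) → CutAt Q T (c′ + s)

module CutTransfer {S k₀ T} (lv : Level S k₀ T)
  (IH : ∀ {c c′ len} → Window S c c′ len → SegmentsTransfer T (radius k₀) c c′ len)
  {c c′ len} (w : Window S c c′ len) where

  private
    pT : Positive T
    pT = proj₂ (level-expands lv)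
    c+len≤ : c + len ≤ ∥ T ∥
    c+len≤ = window-fits lv w
    c′+len≤ : c′ + len ≤ ∥ T ∥
    c′+len≤ = window-fits lv (window-sym w)
    fwd : SegmentsTransfer T (radius k₀) c c′ len
    fwd = IH w
    bwd : SegmentsTransfer T (radius k₀) c′ c len
    bwd = IH (window-sym w)

    k R₀ f r : ℕ
    k = suc k₀
    R₀ = radius k₀
    f = floorℓ-suc k₀
    r = radius k

    room : ∀ {s w x} → r + r ≤ s → w ≤ f → x ≤ f → R₀ + R₀ + w + x ≤ s
    room {s} h₁ w≤f x≤f = ≤-trans (+-mono-≤ (+-monoʳ-≤ (R₀ + R₀) w≤f) x≤f) (subst (_≤ s) (regroup R₀ f) h₁)
      where
      regroup : ∀ a b → a + b + (a + b) ≡ a + a + b + b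
      regroup = solve-∀

    left-room : ∀ {s x} → r + r ≤ s → x ≤ f → R₀ + R₀ + x ≤ s
    left-room h₁ x≤f = ≤-trans (m≤m+n _ _) (room h₁ x≤f x≤f)

    inner-room : ∀ {s} → r + r ≤ s → R₀ + R₀ ≤ s
    inner-room h₁ = ≤-trans (m≤m+n _ _) (left-room h₁ z≤n)

    right-room : ∀ {s} → s + r ≤ len → s + R₀ ≤ len
    right-room {s} h₂ = ≤-trans (+-monoʳ-≤ s (m≤m+n R₀ f)) h₂

    right-room′ : ∀ {s y} → s + r ≤ len → y ≤ f → s + y + R₀ ≤ len
    right-room′ {s} {y} h₂ y≤f = ≤-trans (≤-reflexive (trans (+-assoc s y R₀) (cong (s +_) (+-comm y R₀))))
                                         (≤-trans (+-monoʳ-≤ s (+-monoʳ-≤ R₀ y≤f)) h₂)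

    1≤r : 1 ≤ r
    1≤r = ≤-trans (floorℓ-suc≥1 k₀) (m≤n+m f R₀)

    1≤s : ∀ {s} → r + r ≤ s → 1 ≤ s
    1≤s h₁ = ≤-trans 1≤r (≤-trans (m≤m+n r r) h₁)

    0≢+ : ∀ {d s} → r + r ≤ s → 0 ≢ d + s
    0≢+ {d} {s} h₁ e = <-irrefl e (≤-trans (1≤s h₁) (m≤n+m s d))

    ∥T∥≢ : ∀ {d s} → d + len ≤ ∥ T ∥ → s + r ≤ len → ∥ T ∥ ≢ d + s
    ∥T∥≢ {d} {s} hd h₂ e = <⇒≱ (+-monoʳ-< d (<-≤-trans (m<m+n s 1≤r) h₂)) (subst (d + len ≤_) e hd)

    ∥∥-++-[] : ∀ {L₁} → T ≡ L₁ ++ [] → ∥ T ∥ ≡ ∥ L₁ ∥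
    ∥∥-++-[] {L₁} e = cong ∥_∥ (trans e (++-identityʳ L₁))

  boundary-split : ∀ {d s} → d + len ≤ ∥ T ∥ → r + r ≤ s → s + r ≤ len → Boundary T (d + s) →
    Σ (List Sym) λ M₀ → Σ Sym λ X → Σ Sym λ Y → Σ (List Sym) λ M₄ → SplitAt T (d + s) M₀ X Y M₄
  boundary-split hd h₁ h₂ (M₁ , []     , e , a) = ⊥-elim (∥T∥≢ hd h₂ (trans (∥∥-++-[] e) a))
  boundary-split hd h₁ h₂ (M₁ , Y ∷ M₄ , e , a) with initLast M₁
  ... | []       = ⊥-elim (0≢+ h₁ a)
  ... | M₀ ∷ʳ′ X = M₀ , X , Y , M₄ , e , a

  interior-cut : ∀ {Q s} → r + r ≤ s → s + r ≤ len → CutAt Q T (c + s) →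
    Σ (List Sym) λ L₀ → Σ Sym λ X → Σ Sym λ Y → Σ (List Sym) λ L₄ → SplitAt T (c + s) L₀ X Y L₄ × Q L₀ X Y
  interior-cut h₁ h₂ (_ , _ , e , a , inj₁ refl)        = ⊥-elim (0≢+ h₁ a)
  interior-cut h₁ h₂ (_ , _ , e , a , inj₂ (inj₁ refl)) = ⊥-elim (∥T∥≢ c+len≤ h₂ (trans (∥∥-++-[] e) a))
  interior-cut h₁ h₂ (_ , _ , e , a , inj₂ (inj₂ (L₀ , X , Y , L₄ , refl , refl , q))) = L₀ , X , Y , L₄ , (e , a) , q

  module _ {s : ℕ} (h₁ : r + r ≤ s) (h₂ : s + r ≤ len)
           {L₀ X Y L₄ M₀ X′ Y′ M₄} (sp : SplitAt T (c + s) L₀ X Y L₄) (sp′ : SplitAt T (c′ + s) M₀ X′ Y′ M₄) where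

    left-neighbour : InA k X′ → X ≡ X′
    left-neighbour X′∈𝒜 = phrase-end-unique pT (split-left sp)
      (phrase-ending-transfer bwd s (split-left sp′) (left-room h₁ (InA⇒∣∣≤floorℓ-suc k₀ X′ X′∈𝒜)) (right-room h₂))

    right-neighbour : InA k Y′ → Y ≡ Y′
    right-neighbour Y′∈𝒜 = phrase-start-unique pT (split-right sp)
      (phrase-starting-transfer bwd s (split-right sp′) (inner-room h₁) (right-room′ h₂ (InA⇒∣∣≤floorℓ-suc k₀ Y′ Y′∈𝒜)))

    second-left-neighbour : ∀ {L₀₀ W} → L₀ ≡ L₀₀ ∷ʳ W → X ≡ X′ → InA k X → InA k W →
      Σ (List Sym) λ M₀₀ → M₀ ≡ M₀₀ ∷ʳ W
    second-left-neighbour {L₀₀} {W} refl refl X∈𝒜 W∈𝒜 = go M₀ refl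
      where
      ∣X∣≤f : ∣ X ∣ ≤ f
      ∣X∣≤f = InA⇒∣∣≤floorℓ-suc k₀ X X∈𝒜
      ∣W∣≤f : ∣ W ∣ ≤ f
      ∣W∣≤f = InA⇒∣∣≤floorℓ-suc k₀ W W∈𝒜
      u : ℕ
      u = s ∸ ∣ X ∣
      u-room : R₀ + R₀ + ∣ W ∣ ≤ u
      u-room = m+n≤o⇒m≤o∸n _ (room h₁ ∣W∣≤f ∣X∣≤f)
      ∣X∣≤s : ∣ X ∣ ≤ s
      ∣X∣≤s = ≤-trans (m≤n+m _ (R₀ + R₀ + ∣ W ∣)) (room h₁ ∣W∣≤f ∣X∣≤f)
      1≤u : 1 ≤ u
      1≤u = ≤-trans (floorℓ-suc≥1 k₀)
              (m+n≤o⇒m≤o∸n f (≤-trans (+-monoˡ-≤ ∣ X ∣ (m≤n+m f (R₀ + R₀))) (room h₁ ≤-refl ∣X∣≤f)))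
      W-phrase : Phrase T ∥ L₀₀ ∥ (c + u) W
      W-phrase = subst (λ z → Phrase T ∥ L₀₀ ∥ z W) (+≡⇒≡+∸ (phrase-length (split-left sp)) ∣X∣≤s)
                   (split-left (trans (proj₁ sp) (∷ʳ-++-∷ (L₀₀ ∷ʳ W) X (Y ∷ L₄)) , refl))
      W-phrase′ : Phrase T (c′ + (u ∸ ∣ W ∣)) (c′ + u) W
      W-phrase′ = phrase-ending-transfer fwd u W-phrase u-room
                    (≤-trans (+-monoˡ-≤ R₀ (m∸n≤m s ∣ X ∣)) (right-room h₂))
      ∥M₀∥≡ : ∥ M₀ ∥ ≡ c′ + u
      ∥M₀∥≡ = +≡⇒≡+∸ (phrase-length (split-left sp′)) ∣X∣≤s
      go : ∀ N₀ → M₀ ≡ N₀ → Σ (List Sym) λ M₀₀ → M₀ ≡ M₀₀ ∷ʳ W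
      go N₀ e with initLast N₀
      ... | []         = ⊥-elim (<-irrefl (trans (cong ∥_∥ (sym e)) ∥M₀∥≡) (≤-trans 1≤u (m≤n+m u c′)))
      ... | M₀₀ ∷ʳ′ W′ = M₀₀ , trans e (cong (M₀₀ ∷ʳ_) (sym (phrase-end-unique pT W-phrase′ W′-phrase)))
        where
        W′-phrase : Phrase T ∥ M₀₀ ∥ (c′ + u) W′
        W′-phrase = subst (λ z → Phrase T ∥ M₀₀ ∥ z W′) (trans (cong ∥_∥ (sym e)) ∥M₀∥≡)
                      (split-left (trans (proj₁ sp′) (trans (cong (λ z → (z ∷ʳ X) ++ Y′ ∷ M₄) e)
                                    (∷ʳ-++-∷ (M₀₀ ∷ʳ W′) X (Y′ ∷ M₄))) , refl))

  cut-transfer : ∀ {Q} → (∀ {s} → r + r ≤ s → s + r ≤ len → ∀ {L₀ X Y L₄ M₀ X′ Y′ M₄} →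
                          SplitAt T (c + s) L₀ X Y L₄ → SplitAt T (c′ + s) M₀ X′ Y′ M₄ → Q L₀ X Y → Q M₀ X′ Y′) →
    CutsTransfer Q T r c c′ len
  cut-transfer stable s h₁ h₂ cut with interior-cut h₁ h₂ cut
  ... | L₀ , X , Y , L₄ , sp , q
    with boundary-split c′+len≤ h₁ h₂ (segments⇒boundaries fwd s (inner-room h₁) (right-room h₂) (L₀ ∷ʳ X , Y ∷ L₄ , sp))
  ... | M₀ , X′ , Y′ , M₄ , sp′ =
    M₀ ∷ʳ X′ , Y′ ∷ M₄ , proj₁ sp′ , proj₂ sp′ , inj₂ (inj₂ (M₀ , X′ , Y′ , M₄ , refl , refl , stable h₁ h₂ sp sp′ q))

  oddCut-transfer : CutsTransfer (OddCut k) T r c c′ len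
  oddCut-transfer = cut-transfer λ h₁ h₂ {L₀} {_} {_} {_} {M₀} sp sp′ →
    -- OddCut ignores its first argument, so L₀ and M₀ cannot be inferred.
    oddCut-stable {k = k} {L₀ = L₀} {M₀ = M₀} (left-neighbour h₁ h₂ sp sp′) (right-neighbour h₁ h₂ sp sp′)

  evenCut-transfer : ∀ π → ValidPerm k T π → CutsTransfer (EvenCut k π) T r c c′ len
  evenCut-transfer π vp = cut-transfer λ h₁ h₂ sp sp′ →
    evenCut-stable {k = k} {π = π} (left-neighbour h₁ h₂ sp sp′) (right-neighbour h₁ h₂ sp sp′)
      λ {L₀₀} {W} L₀≡ πW>πX X∈𝒜 X≡X′ → second-left-neighbour h₁ h₂ sp sp′ L₀≡ X≡X′ X∈𝒜
        (locMin-left∈𝒜 {k = k} vp (split-∈-before sp L₀≡) (split-∈ sp) πW>πX X∈𝒜)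

phrase-parent : ∀ mk bs → PreservesExpansion mk bs → ∀ {x y A} → Phrase (map mk bs) x y A →
  Σ (List Sym) λ b → A ≡ mk b × Segment (concat bs) x y b
phrase-parent mk bs me {x} {y} {A} (L₁ , L₂ , e , a , ∥∥≡) with map-++-inv mk bs L₁ (A ∷ L₂) e
... | b₁ , b ∷ b₂ , refl , refl , e₂ with ∷-injective e₂
... | A≡ , _ = b , A≡ , concat b₁ , concat b₂ , sym (concat-++ b₁ (b ∷ b₂)) , a′ , b′
  where
  a′ : ∥ concat b₁ ∥ ≡ x
  a′ = trans (sym (∥map∥ mk b₁ (All.++⁻ˡ b₁ me))) a
  b′ : x + ∥ b ∥ ≡ y
  b′ = trans (cong (x +_) (sym (trans (∥[-]∥ A) (trans (cong ∣_∣ A≡) (cong length (All.head (All.++⁻ʳ b₁ me))))))) ∥∥≡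

phrase-end-≤-transferred : ∀ {T r c c′ len s t u A} → Positive T → BoundariesTransfer T r c c′ len →
  r + r ≤ s → s < t → t + r ≤ len → Boundary T (c + t) → Phrase T (c′ + s) (c′ + u) A → u ≤ t
phrase-end-≤-transferred {c′ = c′} pT bd h₁ s<t h₃ bd-t ph =
  +-cancelˡ-≤ c′ _ _ (phrase-end-≤-boundary pT ph (bd _ (≤-trans h₁ (<⇒≤ s<t)) h₃ bd-t) (+-monoʳ-< c′ s<t))

module StepTransfer {mk T bs} (concat-bs : concat bs ≡ T) (me : PreservesExpansion mk bs)
  (pT : Positive T) (pT′ : Positive (map mk bs)) {r₀ r c c′ len} (r₀≤r : r₀ ≤ r)
  (c′+len≤ : c′ + len ≤ ∥ map mk bs ∥)
  (bd-fwd : BoundariesTransfer (map mk bs) r c c′ len) (bd-bwd : BoundariesTransfer (map mk bs) r c′ c len)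
  (sg-bwd : SegmentsTransfer T r₀ c′ c len) where

  private
    T′ : List Sym
    T′ = map mk bs

  phrase-transfer : ∀ s t A → r + r ≤ s → s ≤ t → t + r ≤ len → Phrase T′ (c + s) (c + t) A → Phrase T′ (c′ + s) (c′ + t) A
  phrase-transfer s t A h₁ s≤t h₃ ph with bd-fwd s h₁ (≤-trans (+-monoˡ-≤ r s≤t) h₃) (segment-start ph)
  ... | U , [] , e , a = ⊥-elim (<⇒≱ c′+s<∥T′∥ (≤-reflexive (trans (cong ∥_∥ (trans e (++-identityʳ U))) a)))
    where
    c′+s<∥T′∥ : c′ + s < ∥ T′ ∥
    c′+s<∥T′∥ = <-≤-trans (+-monoʳ-< c′ (<-≤-trans (+-cancelˡ-< c s t (phrase-< pT′ ph)) (≤-trans (m≤m+n t r) h₃))) c′+len≤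
  ... | U , A′ ∷ V , e , a = subst (Phrase T′ (c′ + s) (c′ + t)) (sym A≡A′) ph″
    where
    u : ℕ
    u = s + ∣ A′ ∣
    ph′ : Phrase T′ (c′ + s) (c′ + u) A′
    ph′ = U , V , e , a , trans (cong (c′ + s +_) (∥[-]∥ A′)) (+-assoc c′ s ∣ A′ ∣)
    s<t : s < t
    s<t = +-cancelˡ-< c s t (phrase-< pT′ ph)
    s<u : s < u
    s<u = +-cancelˡ-< c′ s u (phrase-< pT′ ph′)
    u≤t : u ≤ t
    u≤t = phrase-end-≤-transferred pT′ bd-fwd h₁ s<t h₃ (segment-end ph) ph′
    t≤u : t ≤ u
    t≤u = phrase-end-≤-transferred pT′ bd-bwd h₁ s<u (≤-trans (+-monoˡ-≤ r u≤t) h₃) (segment-end ph′) ph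
    ph″ : Phrase T′ (c′ + s) (c′ + t) A′
    ph″ = subst (λ z → Phrase T′ (c′ + s) (c′ + z) A′) (≤-antisym u≤t t≤u) ph′
    A≡A′ : A ≡ A′
    A≡A′ with phrase-parent mk bs me ph | phrase-parent mk bs me ph″
    ... | b , A≡ , sg | b′ , A′≡ , sg′ = trans A≡ (trans (cong mk b≡b′) (sym A′≡))
      where
      b≡b′ : b ≡ b′
      b≡b′ = segment-unique pT (subst (λ X → Segment X (c + s) (c + t) b) concat-bs sg)
               (sg-bwd s t b′ (≤-trans (+-mono-≤ r₀≤r r₀≤r) h₁) s≤t (≤-trans (+-monoʳ-≤ t r₀≤r) h₃)
                 (subst (λ X → Segment X (c′ + s) (c′ + t) b′) concat-bs sg′))

  segments-transfer : SegmentsTransfer T′ r c c′ len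
  segments-transfer s t [] h₁ s≤t h₃ sg =
    subst (λ z → Segment T′ (c′ + s) (c′ + z) []) s≡t
      (boundary⇒segment-[] (bd-fwd s h₁ (≤-trans (+-monoˡ-≤ r s≤t) h₃) (segment-start sg)))
    where
    s≡t : s ≡ t
    s≡t = +-cancelˡ-≡ c s t (trans (sym (+-identityʳ (c + s))) (proj₂ (proj₂ (proj₂ (proj₂ sg)))))
  segments-transfer s t (A ∷ L) h₁ s≤t h₃ sg with segment-uncons sg
  ... | ph , rest = segment-cons pT′ (phrase-transfer s u A h₁ s≤u (≤-trans (+-monoˡ-≤ r u≤t) h₃) ph′)
                                     (segments-transfer u t L (≤-trans h₁ (m≤m+n s _)) u≤t h₃ rest′)
    where
    u : ℕ
    u = s + ∣ A ∣
    ph′ : Phrase T′ (c + s) (c + u) A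
    ph′ = subst (λ z → Phrase T′ (c + s) z A) (+-assoc c s ∣ A ∣) ph
    rest′ : Segment T′ (c + u) (c + t) L
    rest′ = subst (λ z → Segment T′ z (c + t) L) (+-assoc c s ∣ A ∣) rest
    s≤u : s ≤ u
    s≤u = m≤m+n s ∣ A ∣
    u≤t : u ≤ t
    u≤t = +-cancelˡ-≤ c u t (segment-≤ rest′)

module _ {S k₀ T mk Bd Q bs} (lv : Level S k₀ T) (lv′ : Level S (suc k₀) (map mk bs))
  (grouping : Grouping T Bd bs) (me : PreservesExpansion mk bs) (rule : BoundaryRule Bd Q T)
  (IH : ∀ {c c′ len} → Window S c c′ len → SegmentsTransfer T (radius k₀) c c′ len)
  (cuts : ∀ {c c′ len} → Window S c c′ len → CutsTransfer Q T (radius (suc k₀)) c c′ len) where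

  step-transfer : ∀ {c c′ len} → Window S c c′ len → SegmentsTransfer (map mk bs) (radius (suc k₀)) c c′ len
  step-transfer w = StepTransfer.segments-transfer (proj₁ (proj₂ grouping)) me
    (proj₂ (level-expands lv)) (proj₂ (level-expands lv′)) (m≤m+n _ _) (window-fits lv′ (window-sym w))
    (boundaries w) (boundaries (window-sym w)) (IH (window-sym w))
    where
    boundaries : ∀ {c c′ len} → Window S c c′ len → BoundariesTransfer (map mk bs) (radius (suc k₀)) c c′ len
    boundaries w s h₁ h₂ = cutAt⇒boundary grouping me rule ∘ cuts w s h₁ h₂ ∘ boundary⇒cutAt grouping me rule

transfer : ∀ k {S T} → Level S k T → ∀ {c c′ len} → Window S c c′ len → SegmentsTransfer T (radius k) c c′ len
transfer zero    lvl0         = leaves-transfer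
transfer (suc k) (lvlS lv st) with stepKind (suc k) st
... | odd (bs , G , refl) =
  step-transfer lv (lvlS lv st) G (mkRun-preservesExpansion {suc k} G) (oddRule (suc k) _) (transfer k lv)
    (CutTransfer.oddCut-transfer lv (transfer k lv))
... | even (π , vp , bs , G , refl) =
  step-transfer lv (lvlS lv st) G (mkBlk-preservesExpansion bs (proj₁ G)) (evenRule (suc k) π _) (transfer k lv)
    (λ w → CutTransfer.evenCut-transfer lv (transfer k lv) w π vp)

module Offsets (m α : ℕ) where

  span : ℕ
  span = m + 2 * α

  start : ℕ → ℕ
  start i = i ∸ span

  len : ℕ
  len = span + α

  i≡ : ∀ {i} → span ≤ i → i ≡ start i + span
  i≡ h = sym (m∸n+n≡m h)

  i∸m≡ : ∀ {i} → span ≤ i → i ∸ m ≡ start i + 2 * α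
  i∸m≡ {i} h = begin
    i ∸ m                           ≡⟨ cong (_∸ m) (i≡ h) ⟩
    start i + (m + 2 * α) ∸ m       ≡⟨ cong (λ z → start i + z ∸ m) (+-comm m (2 * α)) ⟩
    start i + (2 * α + m) ∸ m       ≡⟨ cong (_∸ m) (+-assoc (start i) (2 * α) m) ⟨
    start i + 2 * α + m ∸ m         ≡⟨ m+n∸n≡m (start i + 2 * α) m ⟩
    start i + 2 * α                 ∎
    where open ≡-Reasoning

  i+α≡ : ∀ {i} → span ≤ i → i + α ≡ start i + len
  i+α≡ {i} h = trans (cong (_+ α) (i≡ h)) (+-assoc (start i) span α)

  sub≡ : ∀ (S : List ℕ) {i} → span ≤ i → sub S (start i) (i + α) ≡ take len (drop (start i) S)
  sub≡ S {i} h = trans (cong (λ z → take (z ∸ start i) (drop (start i) S)) (i+α≡ h))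
                       (cong (λ z → take z (drop (start i) S)) (m+n∸m≡n (start i) len))

  radius-room : ∀ {R} → R ≤ α → R + R ≤ 2 * α
  radius-room R≤α = +-mono-≤ R≤α (subst (_ ≤_) (sym (+-identityʳ α)) R≤α)

lemma1 : (σ : ℕ) (S : List ℕ) → All (_< σ) S →
    (k m α : ℕ) → α ≥ floor8ℓ k →
    (i i' : ℕ) → m + 2 * α ≤ i → i + α ≤ length S → m + 2 * α ≤ i' → i' + α ≤ length S →
    sub S (i ∸ (m + 2 * α)) (i + α) ≡ sub S (i' ∸ (m + 2 * α)) (i' + α) →
    (Sk : List Sym) → Level S k Sk →
    (InB Sk i → InB Sk i')
    × (∀ j A → PhraseAt Sk j A (i ∸ m) i → Σ ℕ λ j' → PhraseAt Sk j' A (i' ∸ m) i')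
lemma1 _ S _ k m α α≥ i i′ h₁ h₂ h₃ h₄ agree Sk lv = boundary , phrase
  where
  open Offsets m α
  R≤α : radius k ≤ α
  R≤α = ≤-trans (radius≤floor8ℓ k) α≥
  window : Window S (start i) (start i′) len
  window = subst (_≤ length S) (i+α≡ h₁) h₂ , subst (_≤ length S) (i+α≡ h₃) h₄ ,
           trans (sym (sub≡ S h₁)) (trans agree (sub≡ S h₃))
  segments : SegmentsTransfer Sk (radius k) (start i) (start i′) len
  segments = transfer k lv window
  boundary : InB Sk i → InB Sk i′
  boundary = boundary⇒inB ∘ subst (Boundary Sk) (sym (i≡ h₃))
           ∘ segments⇒boundaries segments span (≤-trans (radius-room R≤α) (m≤n+m _ m)) (+-monoʳ-≤ span R≤α)
           ∘ subst (Boundary Sk) (i≡ h₁) ∘ inB⇒boundary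
  phrase : ∀ j A → PhraseAt Sk j A (i ∸ m) i → Σ ℕ λ j′ → PhraseAt Sk j′ A (i′ ∸ m) i′
  phrase j A = phrase⇒phraseAt ∘ subst₂ (λ x y → Phrase Sk x y A) (sym (i∸m≡ h₃)) (sym (i≡ h₃))
             ∘ segments (2 * α) span (A ∷ []) (radius-room R≤α) (m≤n+m _ m) (+-monoʳ-≤ span R≤α)
             ∘ subst₂ (λ x y → Phrase Sk x y A) (i∸m≡ h₁) (i≡ h₁) ∘ phraseAt⇒phrase
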